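{- Assume Schinzel's Hypothesis H. Let $A=\{a\in\mathbb{Z}_{>0} : a^2+1 \text{ is prime}\}$, enumerated increasingly as $a_1<a_2<a_3<\cdots$. Then $\liminf_{n\to\infty} j(a_n)=1$.
   Context: For $n\ge 2$, $j(a_n)$ denotes the smallest integer $i$ with $1\le i\le n-1$ such that $a_n-a_{n-i}\in A$ (with $j(a_n)=\infty$ if no such $i$ exists). A finite set of polynomials $f_1,\dots,f_k\in\mathbb{Z}[x]$ satisfies the Bunyakovsky condition if there is no prime $p$ such that $\prod_i f_i(a)\equiv 0 \pmod p$ for all $a\in\mathbb{F}_p$. Schinzel's Hypothesis H: if $f_1,\dots,f_k\in\mathbb{Z}[x]$ are irreducible with positive leading coefficients and satisfy the Bunyakovsky condition, then there are infinitely many positive integers $x$ for which $f_1(x),\dots,f_k(x)$ are all prime. -}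

module Defs where

open import Data.Nat as ℕ using (ℕ; zero; suc; _∸_; _≤_; _<_)
open import Data.Nat.Primality using (Prime; prime?)
open import Data.Integer as ℤ using (ℤ; +_; -[1+_])
open import Data.Integer.Divisibility as ℤD using ()
open import Data.List using (List; []; _∷_; map; foldr)
open import Data.List.Relation.Unary.All using (All)
open import Data.Maybe using (Maybe; just; nothing)
open import Data.Product using (Σ; ∃; ∃-syntax; _×_; _,_)
open import Data.Sum using (_⊎_)
open import Data.Bool using (if_then_else_)
open import Relation.Nullary using (¬_; Dec; does)
open import Relation.Nullary.Decidable using (_×-dec_)
open import Relation.Binary.PropositionalEquality using (_≡_)

-- Polynomials in ℤ[x] as coefficient lists, lowest degree first.

Poly : Set
Poly = List ℤ

coeff : Poly → ℕ → ℤ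
coeff []       _       = + 0
coeff (c ∷ p)  zero    = c
coeff (c ∷ p)  (suc k) = coeff p k

-- equality of polynomials (coefficientwise; trailing zeros irrelevant)
_≈ₚ_ : Poly → Poly → Set
p ≈ₚ q = ∀ k → coeff p k ≡ coeff q k

_+ₚ_ : Poly → Poly → Poly
[]      +ₚ q       = q
(c ∷ p) +ₚ []      = c ∷ p
(c ∷ p) +ₚ (d ∷ q) = (c ℤ.+ d) ∷ (p +ₚ q)

_*ₚ_ : Poly → Poly → Poly
[]      *ₚ q = []
(c ∷ p) *ₚ q = map (c ℤ.*_) q +ₚ (+ 0 ∷ (p *ₚ q))

eval : Poly → ℤ → ℤ
eval []      x = + 0
eval (c ∷ p) x = c ℤ.+ x ℤ.* eval p x

-- leading coefficient (last nonzero coefficient; 0 for the zero polynomial)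
lead : Poly → ℤ
lead []      = + 0
lead (c ∷ p) with lead p
... | + zero    = c
... | + (suc n) = + suc n
... | -[1+ n ]  = -[1+ n ]

IsUnit : Poly → Set
IsUnit g = (g ≈ₚ (+ 1 ∷ [])) ⊎ (g ≈ₚ (-[1+ 0 ] ∷ []))

Irreducible : Poly → Set
Irreducible f =
  ¬ (f ≈ₚ []) × ¬ IsUnit f ×
  (∀ g h → f ≈ₚ (g *ₚ h) → IsUnit g ⊎ IsUnit h)

IsPrimeℤ : ℤ → Set
IsPrimeℤ z = ∃[ q ] (z ≡ + q × Prime q)

prodEval : List Poly → ℤ → ℤ
prodEval fs a = foldr (λ f r → eval f a ℤ.* r) (+ 1) fs

-- Bunyakovsky condition: no prime p divides ∏ fᵢ(a) for all a ∈ 𝔽ₚ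
-- (a ranging over the residues 0,…,p-1)
Bunyakovsky : List Poly → Set
Bunyakovsky fs =
  ¬ (∃[ p ] (Prime p × (∀ (a : ℕ) → a < p → (+ p) ℤD.∣ prodEval fs (+ a))))

HypothesisH : Set
HypothesisH =
  ∀ (fs : List Poly) →
  All Irreducible fs →
  All (λ f → + 0 ℤ.< lead f) fs →
  Bunyakovsky fs →
  ∀ (N : ℕ) → ∃[ x ] (N < x × All (λ f → IsPrimeℤ (eval f (+ x))) fs)

InA : ℕ → Set
InA a = 0 < a × Prime (a ℕ.* a ℕ.+ 1)

inA? : (a : ℕ) → Dec (InA a)
inA? a = (0 ℕ.<? a) ×-dec prime? (a ℕ.* a ℕ.+ 1)

-- a : ℕ → ℕ is the increasing enumeration a₁ < a₂ < … of A
-- (1-based: the value a 0 is irrelevant)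
IsEnumerationOfA : (ℕ → ℕ) → Set
IsEnumerationOfA a =
  (∀ n → 1 ≤ n → a n < a (suc n)) ×
  (∀ n → 1 ≤ n → InA (a n)) ×
  (∀ b → InA b → ∃[ n ] (1 ≤ n × a n ≡ b))

jSearch : (ℕ → ℕ) → ℕ → ℕ → ℕ → Maybe ℕ
jSearch a n i zero     = nothing
jSearch a n i (suc f)  =
  if does (inA? (a n ∸ a (n ∸ i))) then just i else jSearch a n (suc i) f

-- j(aₙ) for n ≥ 2: least i ∈ [1, n-1] with aₙ - a_{n-i} ∈ A; nothing = ∞
j : (ℕ → ℕ) → ℕ → Maybe ℕ
j a n = jSearch a n 1 (n ∸ 1)

-- liminf_{n→∞} s n = 1 for a sequence (n ≥ 2) with values in ℕ ∪ {∞}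
-- (nothing = ∞): s n = 1 infinitely often, and eventually s n ≥ 1.
LiminfEqOne : (ℕ → Maybe ℕ) → Set
LiminfEqOne s =
  (∀ N → ∃[ n ] (N ≤ n × 2 ≤ n × s n ≡ just 1)) ×
  (∃[ N ] (∀ n k → N ≤ n → s n ≡ just k → 1 ≤ k))

{-# OPTIONS --safe #-}

-- Hypothesis H for x² + 1 and (x + 2)² + 1 gives arbitrarily large x with x, x + 2 ∈ A; in
-- particular A is infinite, so its increasing enumeration exists. For x ≥ 2 one of x² + 1 and
-- (x + 1)² + 1 is an even number greater than 2, so x + 1 ∉ A and x + 2 is the successor of x in
-- A. Their difference 2 lies in A (2² + 1 = 5), so j = 1 at x + 2.

module Submission where

open import Defs
open import Data.Nat as ℕ using (ℕ; zero; suc; z≤n; s≤s; s≤s⁻¹; _≤_; _<_; _∸_; _≤′_; ≤′-refl; ≤′-step)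
import Data.Nat.Properties as ℕP
open import Data.Nat.Divisibility using (_∣_; divides; _∣?_; ∣m∣n⇒∣m+n; n∣m*n)
import Data.Nat.Tactic.RingSolver as ℕSolver
open import Data.Nat.Primality using (Prime; prime?; prime⇒irreducible; prime⇒nonZero; ¬prime[1])
open import Data.Integer as ℤ using (ℤ; +_; -[1+_]; 0ℤ; 1ℤ; -1ℤ; _+_; _*_; _-_; -_)
import Data.Integer.Properties as ℤP
open import Data.Integer.Tactic.RingSolver using (solve-∀)
open import Data.List using (List; []; _∷_; map)
open import Data.List.Relation.Unary.All using ([]; _∷_)
open import Data.Maybe using (just)
open import Data.Maybe.Properties using (just-injective)
open import Data.Bool using (true; false; if_then_else_)
open import Data.Product using (∃; ∃-syntax; _×_; _,_; proj₁; proj₂; map₂)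
open import Data.Sum using (_⊎_; inj₁; inj₂; [_,_]′)
open import Function using (_∘_)
open import Relation.Nullary using (¬_; yes; no; does; contradiction)
open import Relation.Nullary.Decidable using (from-yes; from-no; dec-true)
open import Relation.Unary using (Decidable)
open import Relation.Binary.Definitions using (tri<; tri≈; tri>)
open import Relation.Binary.PropositionalEquality
open ≡-Reasoning

VanishesFrom : Poly → ℕ → Set
VanishesFrom p m = ∀ k → m ≤ k → coeff p k ≡ 0ℤ

infix 4 _HasDegree_
_HasDegree_ : Poly → ℕ → Set
p HasDegree d = VanishesFrom p (suc d) × coeff p d ≢ 0ℤ

coeff-+ₚ : ∀ p q k → coeff (p +ₚ q) k ≡ coeff p k + coeff q k
coeff-+ₚ []      q       k       = sym (ℤP.+-identityˡ _)
coeff-+ₚ (c ∷ p) []      k       = sym (ℤP.+-identityʳ _)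
coeff-+ₚ (c ∷ p) (d ∷ q) zero    = refl
coeff-+ₚ (c ∷ p) (d ∷ q) (suc k) = coeff-+ₚ p q k

coeff-scale : ∀ c q k → coeff (map (c *_) q) k ≡ c * coeff q k
coeff-scale c []      k       = sym (ℤP.*-zeroʳ c)
coeff-scale c (d ∷ q) zero    = refl
coeff-scale c (d ∷ q) (suc k) = coeff-scale c q k

coeff-∷-*ₚ : ∀ c p q k → coeff ((c ∷ p) *ₚ q) k ≡ c * coeff q k + coeff (0ℤ ∷ (p *ₚ q)) k
coeff-∷-*ₚ c p q k = trans (coeff-+ₚ (map (c *_) q) _ k) (cong (_+ _) (coeff-scale c q k))

*ₚ-zeroˡ : ∀ p q → p ≈ₚ [] → (p *ₚ q) ≈ₚ []
*ₚ-zeroˡ []      q _   k       = refl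
*ₚ-zeroˡ (c ∷ p) q p≈0 zero    =
  trans (coeff-∷-*ₚ c p q 0) (cong (λ c → c * coeff q 0 + 0ℤ) (p≈0 0))
*ₚ-zeroˡ (c ∷ p) q p≈0 (suc k) =
  trans (coeff-∷-*ₚ c p q (suc k))
        (cong₂ (λ c r → c * coeff q (suc k) + r) (p≈0 0) (*ₚ-zeroˡ p q (p≈0 ∘ suc) k))

*ₚ-zeroʳ : ∀ p q → q ≈ₚ [] → (p *ₚ q) ≈ₚ []
*ₚ-zeroʳ []      q _   k = refl
*ₚ-zeroʳ (c ∷ p) q q≈0 k = begin
  coeff ((c ∷ p) *ₚ q) k                  ≡⟨ coeff-∷-*ₚ c p q k ⟩
  c * coeff q k + coeff (0ℤ ∷ (p *ₚ q)) k  ≡⟨ cong₂ (λ x r → c * x + r) (q≈0 k) (tail≈0 k) ⟩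
  c * 0ℤ + 0ℤ                              ≡⟨ cong (_+ 0ℤ) (ℤP.*-zeroʳ c) ⟩
  0ℤ                                       ∎
  where
  tail≈0 : (0ℤ ∷ (p *ₚ q)) ≈ₚ []
  tail≈0 zero    = refl
  tail≈0 (suc k) = *ₚ-zeroʳ p q q≈0 k

coeff-const-*ₚ : ∀ c p q k → p ≈ₚ [] → coeff ((c ∷ p) *ₚ q) k ≡ c * coeff q k
coeff-const-*ₚ c p q k p≈0 = begin
  coeff ((c ∷ p) *ₚ q) k                  ≡⟨ coeff-∷-*ₚ c p q k ⟩
  c * coeff q k + coeff (0ℤ ∷ (p *ₚ q)) k  ≡⟨ cong (λ r → c * coeff q k + r) (tail≈0 k) ⟩
  c * coeff q k + 0ℤ                       ≡⟨ ℤP.+-identityʳ _ ⟩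
  c * coeff q k                            ∎
  where
  tail≈0 : (0ℤ ∷ (p *ₚ q)) ≈ₚ []
  tail≈0 zero    = refl
  tail≈0 (suc k) = *ₚ-zeroˡ p q p≈0 k

coeff-∷-*ₚ-suc : ∀ c p q k → coeff q (suc k) ≡ 0ℤ → coeff ((c ∷ p) *ₚ q) (suc k) ≡ coeff (p *ₚ q) k
coeff-∷-*ₚ-suc c p q k q≡0 = begin
  coeff ((c ∷ p) *ₚ q) (suc k)             ≡⟨ coeff-∷-*ₚ c p q (suc k) ⟩
  c * coeff q (suc k) + coeff (p *ₚ q) k   ≡⟨ cong (λ x → c * x + coeff (p *ₚ q) k) q≡0 ⟩
  c * 0ℤ + coeff (p *ₚ q) k                ≡⟨ cong (_+ coeff (p *ₚ q) k) (ℤP.*-zeroʳ c) ⟩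
  0ℤ + coeff (p *ₚ q) k                    ≡⟨ ℤP.+-identityˡ _ ⟩
  coeff (p *ₚ q) k                         ∎

coeff-*ₚ-top : ∀ p q m n → VanishesFrom p (suc m) → VanishesFrom q (suc n) →
               VanishesFrom (p *ₚ q) (suc (m ℕ.+ n)) ×
               coeff (p *ₚ q) (m ℕ.+ n) ≡ coeff p m * coeff q n
coeff-*ₚ-top []      q m       n p-vanish q-vanish = (λ _ _ → refl) , refl
coeff-*ₚ-top (c ∷ p) q zero    n p-vanish q-vanish =
  (λ k n<k → trans (coeff-const-*ₚ c p q k p≈0) (trans (cong (c *_) (q-vanish k n<k)) (ℤP.*-zeroʳ c))) ,
  coeff-const-*ₚ c p q n p≈0
  where
  p≈0 : p ≈ₚ []
  p≈0 k = p-vanish (suc k) (s≤s z≤n)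
coeff-*ₚ-top (c ∷ p) q (suc m) n p-vanish q-vanish =
  (λ { (suc k) (s≤s m+n<k) → trans (coeff-∷-*ₚ-suc c p q k (q-vanish (suc k) (s≤s (n≤k m+n<k))))
                                    (proj₁ ih k m+n<k) }) ,
  trans (coeff-∷-*ₚ-suc c p q (m ℕ.+ n) (q-vanish (suc (m ℕ.+ n)) (s≤s (ℕP.m≤n+m n m)))) (proj₂ ih)
  where
  ih : VanishesFrom (p *ₚ q) (suc (m ℕ.+ n)) × coeff (p *ₚ q) (m ℕ.+ n) ≡ coeff p m * coeff q n
  ih = coeff-*ₚ-top p q m n (λ k m<k → p-vanish (suc k) (s≤s m<k)) q-vanish
  n≤k : ∀ {k} → suc (m ℕ.+ n) ≤ k → n ≤ k
  n≤k m+n<k = ℕP.≤-trans (ℕP.m≤n+m n (suc m)) m+n<k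

degree-or-zero : ∀ p → p ≈ₚ [] ⊎ ∃[ d ] p HasDegree d
degree-or-zero []      = inj₁ (λ _ → refl)
degree-or-zero (c ∷ p) with degree-or-zero p
... | inj₂ (d , p-vanish , lead≢0) = inj₂ (suc d , (λ { (suc k) (s≤s d<k) → p-vanish k d<k }) , lead≢0)
... | inj₁ p≈0 with c ℤ.≟ 0ℤ
...   | yes c≡0 = inj₁ λ { zero → c≡0 ; (suc k) → p≈0 k }
...   | no c≢0  = inj₂ (0 , (λ { (suc k) _ → p≈0 k }) , c≢0)

*ₚ-hasDegree : ∀ g h {d e} → g HasDegree d → h HasDegree e → (g *ₚ h) HasDegree (d ℕ.+ e)
*ₚ-hasDegree g h {d} {e} (g-vanish , g≢0) (h-vanish , h≢0) =
  proj₁ top , λ gh≡0 → [ g≢0 , h≢0 ]′ (ℤP.i*j≡0⇒i≡0∨j≡0 _ (trans (sym (proj₂ top)) gh≡0))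
  where
  top : VanishesFrom (g *ₚ h) (suc (d ℕ.+ e)) × coeff (g *ₚ h) (d ℕ.+ e) ≡ coeff g d * coeff h e
  top = coeff-*ₚ-top g h d e g-vanish h-vanish

degree-unique : ∀ p q {d e} → p ≈ₚ q → p HasDegree d → q HasDegree e → d ≡ e
degree-unique p q {d} {e} p≈q (p-vanish , p≢0) (q-vanish , q≢0) with ℕP.<-cmp d e
... | tri< d<e _ _ = contradiction (trans (sym (p≈q e)) (p-vanish e d<e)) q≢0
... | tri≈ _ d≡e _ = d≡e
... | tri> _ _ e<d = contradiction (trans (p≈q d) (q-vanish d e<d)) p≢0

eval-+ₚ : ∀ p q x → eval (p +ₚ q) x ≡ eval p x + eval q x
eval-+ₚ []      q       x = sym (ℤP.+-identityˡ _)
eval-+ₚ (c ∷ p) []      x = sym (ℤP.+-identityʳ _)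
eval-+ₚ (c ∷ p) (d ∷ q) x = begin
  (c + d) + x * eval (p +ₚ q) x         ≡⟨ cong (λ r → (c + d) + x * r) (eval-+ₚ p q x) ⟩
  (c + d) + x * (eval p x + eval q x)   ≡⟨ regroup c d x (eval p x) (eval q x) ⟩
  (c + x * eval p x) + (d + x * eval q x) ∎
  where
  regroup : ∀ c d x a b → (c + d) + x * (a + b) ≡ (c + x * a) + (d + x * b)
  regroup = solve-∀

eval-scale : ∀ c q x → eval (map (c *_) q) x ≡ c * eval q x
eval-scale c []      x = sym (ℤP.*-zeroʳ c)
eval-scale c (d ∷ q) x = begin
  c * d + x * eval (map (c *_) q) x ≡⟨ cong (λ r → c * d + x * r) (eval-scale c q x) ⟩
  c * d + x * (c * eval q x)        ≡⟨ regroup c d x (eval q x) ⟩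
  c * (d + x * eval q x)            ∎
  where
  regroup : ∀ c d x a → c * d + x * (c * a) ≡ c * (d + x * a)
  regroup = solve-∀

eval-*ₚ : ∀ p q x → eval (p *ₚ q) x ≡ eval p x * eval q x
eval-*ₚ []      q x = refl
eval-*ₚ (c ∷ p) q x = begin
  eval (map (c *_) q +ₚ (0ℤ ∷ (p *ₚ q))) x
    ≡⟨ eval-+ₚ (map (c *_) q) _ x ⟩
  eval (map (c *_) q) x + (0ℤ + x * eval (p *ₚ q) x)
    ≡⟨ cong₂ (λ s r → s + (0ℤ + x * r)) (eval-scale c q x) (eval-*ₚ p q x) ⟩
  c * eval q x + (0ℤ + x * (eval p x * eval q x))
    ≡⟨ regroup c x (eval p x) (eval q x) ⟩
  (c + x * eval p x) * eval q x
    ∎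
  where
  regroup : ∀ c x a b → c * b + (0ℤ + x * (a * b)) ≡ (c + x * a) * b
  regroup = solve-∀

eval-≈[] : ∀ p x → p ≈ₚ [] → eval p x ≡ 0ℤ
eval-≈[] []      x _   = refl
eval-≈[] (c ∷ p) x p≈0 = begin
  c + x * eval p x ≡⟨ cong₂ (λ c r → c + x * r) (p≈0 0) (eval-≈[] p x (p≈0 ∘ suc)) ⟩
  0ℤ + x * 0ℤ      ≡⟨ cong (λ r → 0ℤ + r) (ℤP.*-zeroʳ x) ⟩
  0ℤ               ∎

eval-cong : ∀ p q x → p ≈ₚ q → eval p x ≡ eval q x
eval-cong []      q       x p≈q = sym (eval-≈[] q x (sym ∘ p≈q))
eval-cong (c ∷ p) []      x p≈q = eval-≈[] (c ∷ p) x p≈q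
eval-cong (c ∷ p) (d ∷ q) x p≈q =
  cong₂ (λ c r → c + x * r) (p≈q 0) (eval-cong p q x (p≈q ∘ suc))

*≡1⇒≡±1 : ∀ i j → i * j ≡ 1ℤ → i ≡ 1ℤ ⊎ i ≡ -1ℤ
*≡1⇒≡±1 i j ij≡1 with ℕP.m*n≡1⇒m≡1 ℤ.∣ i ∣ ℤ.∣ j ∣ (trans (sym (ℤP.abs-* i j)) (cong ℤ.∣_∣ ij≡1))
*≡1⇒≡±1 (+ 1)    j _ | refl = inj₁ refl
*≡1⇒≡±1 -[1+ 0 ] j _ | refl = inj₂ refl

constant-isUnit : ∀ g i → VanishesFrom g 1 → coeff g 0 * i ≡ 1ℤ → IsUnit g
constant-isUnit g i g-vanish g₀i≡1 with *≡1⇒≡±1 (coeff g 0) i g₀i≡1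
... | inj₁ g₀≡1  = inj₁ λ { zero → g₀≡1  ; (suc k) → g-vanish (suc k) (s≤s z≤n) }
... | inj₂ g₀≡-1 = inj₂ λ { zero → g₀≡-1 ; (suc k) → g-vanish (suc k) (s≤s z≤n) }

linear-root : ∀ g i → VanishesFrom g 2 → coeff g 1 * i ≡ 1ℤ → eval g (- (coeff g 0 * i)) ≡ 0ℤ
linear-root g i g-vanish g₁i≡1 = begin
  eval g z                      ≡⟨ eval-cong g (g₀ ∷ g₁ ∷ []) z g≈linear ⟩
  g₀ + z * (g₁ + z * 0ℤ)        ≡⟨ expand g₀ g₁ i ⟩
  g₀ - g₀ * (g₁ * i)            ≡⟨ cong (λ u → g₀ - g₀ * u) g₁i≡1 ⟩
  g₀ - g₀ * 1ℤ                  ≡⟨ cancel g₀ ⟩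
  0ℤ                            ∎
  where
  g₀ g₁ z : ℤ
  g₀ = coeff g 0
  g₁ = coeff g 1
  z  = - (g₀ * i)
  g≈linear : g ≈ₚ (g₀ ∷ g₁ ∷ [])
  g≈linear zero          = refl
  g≈linear (suc zero)    = refl
  g≈linear (suc (suc k)) = g-vanish (suc (suc k)) (s≤s (s≤s z≤n))
  expand : ∀ a b i → a + (- (a * i)) * (b + (- (a * i)) * 0ℤ) ≡ a - a * (b * i)
  expand = solve-∀
  cancel : ∀ a → a - a * 1ℤ ≡ 0ℤ
  cancel = solve-∀

factor-root : ∀ f g h z → f ≈ₚ (g *ₚ h) → eval g z ≡ 0ℤ → eval f z ≡ 0ℤ
factor-root f g h z f≈gh gz≡0 = begin
  eval f z             ≡⟨ eval-cong f (g *ₚ h) z f≈gh ⟩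
  eval (g *ₚ h) z      ≡⟨ eval-*ₚ g h z ⟩
  eval g z * eval h z  ≡⟨ cong (_* eval h z) gz≡0 ⟩
  0ℤ                   ∎

monicQuadratic-irreducible : ∀ c b → (∀ z → eval (c ∷ b ∷ 1ℤ ∷ []) z ≢ 0ℤ) →
                             Irreducible (c ∷ b ∷ 1ℤ ∷ [])
monicQuadratic-irreducible c b rootless =
  (λ f≈0 → 1≢0 (f≈0 2)) , [ (λ f≈1 → 1≢0 (f≈1 2)) , (λ f≈-1 → 1≢0 (f≈-1 2)) ]′ , factors
  where
  f : Poly
  f = c ∷ b ∷ 1ℤ ∷ []
  1≢0 : 1ℤ ≢ 0ℤ
  1≢0 ()
  f-degree : f HasDegree 2
  f-degree = (λ { _ (s≤s (s≤s (s≤s _))) → refl }) , 1≢0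
  factors : ∀ g h → f ≈ₚ (g *ₚ h) → IsUnit g ⊎ IsUnit h
  factors g h f≈gh with degree-or-zero g | degree-or-zero h
  ... | inj₁ g≈0 | _ = contradiction (trans (f≈gh 2) (*ₚ-zeroˡ g h g≈0 2)) 1≢0
  ... | inj₂ _ | inj₁ h≈0 = contradiction (trans (f≈gh 2) (*ₚ-zeroʳ g h h≈0 2)) 1≢0
  ... | inj₂ (d , g-degree) | inj₂ (e , h-degree) =
    split g-degree h-degree
      (degree-unique f (g *ₚ h) f≈gh f-degree (*ₚ-hasDegree g h g-degree h-degree))
      (trans (sym (proj₂ (coeff-*ₚ-top g h d e (proj₁ g-degree) (proj₁ h-degree)))) (sym (f≈gh (d ℕ.+ e))))
    where
    -- The leading coefficients multiply to 1: a constant factor is a unit, a linear one has a root.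
    split : ∀ {d e} → g HasDegree d → h HasDegree e → 2 ≡ d ℕ.+ e →
            coeff g d * coeff h e ≡ coeff f (d ℕ.+ e) → IsUnit g ⊎ IsUnit h
    split {0}                 {_}           g-deg _     refl lead =
      inj₁ (constant-isUnit g (coeff h 2) (proj₁ g-deg) lead)
    split {2}                 {0}           _     h-deg refl lead =
      inj₂ (constant-isUnit h (coeff g 2) (proj₁ h-deg) (trans (ℤP.*-comm (coeff h 0) (coeff g 2)) lead))
    split {1}                 {1}           g-deg _     refl lead =
      contradiction (factor-root f g h z f≈gh (linear-root g (coeff h 1) (proj₁ g-deg) lead)) (rootless z)
      where
      z : ℤ
      z = - (coeff g 0 * coeff h 1)
    split {1}                 {0}           _     _     ()   _
    split {1}                 {suc (suc _)} _     _     ()   _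
    split {2}                 {suc _}       _     _     ()   _
    split {suc (suc (suc _))} {_}           _     _     ()   _

IsLeastAbove : (ℕ → Set) → ℕ → ℕ → Set
IsLeastAbove P lo m = lo < m × P m × (∀ c → lo < c → c < m → ¬ P c)

leastAbove-unique : ∀ {P lo m n} → IsLeastAbove P lo m → IsLeastAbove P lo n → m ≡ n
leastAbove-unique {m = m} {n} (lo<m , Pm , m-least) (lo<n , Pn , n-least) with ℕP.<-cmp m n
... | tri< m<n _ _ = contradiction Pm (n-least m lo<m m<n)
... | tri≈ _ m≡n _ = m≡n
... | tri> _ _ n<m = contradiction Pn (m-least n lo<n n<m)

leastAbove-suc : ∀ {P lo} → P (suc lo) → IsLeastAbove P lo (suc lo)
leastAbove-suc {lo = lo} P[1+lo] =
  ℕP.n<1+n lo , P[1+lo] , λ c lo<c c<1+lo → contradiction (s≤s⁻¹ c<1+lo) (ℕP.<⇒≱ lo<c)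

leastAbove-skip : ∀ {P lo m} → ¬ P (suc lo) → IsLeastAbove P (suc lo) m → IsLeastAbove P lo m
leastAbove-skip {P} {lo} {m} ¬P[1+lo] (1+lo<m , Pm , m-least) =
  ℕP.<-trans (ℕP.n<1+n lo) 1+lo<m , Pm , below-m
  where
  below-m : ∀ c → lo < c → c < m → ¬ P c
  below-m c lo<c c<m with ℕP.m≤n⇒m<n∨m≡n lo<c
  ... | inj₁ 1+lo<c = m-least c 1+lo<c c<m
  ... | inj₂ refl   = ¬P[1+lo]

leastAbove : ∀ {P} → Decidable P → ∀ {lo x} → lo < x → P x → ∃ (IsLeastAbove P lo)
leastAbove {P} P? {lo} lo<x Px = search lo _ (subst P (sym (ℕP.m+[n∸m]≡n lo<x)) Px)
  where
  search : ∀ lo k → P (suc lo ℕ.+ k) → ∃ (IsLeastAbove P lo)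
  search lo zero    P[1+lo+k] = suc lo , leastAbove-suc (subst P (ℕP.+-identityʳ (suc lo)) P[1+lo+k])
  search lo (suc k) P[1+lo+k] with P? (suc lo)
  ... | yes P[1+lo] = suc lo , leastAbove-suc P[1+lo]
  ... | no ¬P[1+lo] =
    map₂ (leastAbove-skip ¬P[1+lo]) (search (suc lo) k (subst P (ℕP.+-suc (suc lo) k) P[1+lo+k]))

module Enumeration {P : ℕ → Set} (P? : Decidable P) (unbounded : ∀ N → ∃[ x ] (N < x × P x)) where

  next : ∀ lo → ∃ (IsLeastAbove P lo)
  next lo = let x , lo<x , Px = unbounded lo in leastAbove P? lo<x Px

  -- enum 0 = 0 lies below every positive element of P, so enum 1, enum 2, … enumerate P ∩ ℕ⁺.
  enum : ℕ → ℕ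
  enum zero    = 0
  enum (suc n) = proj₁ (next (enum n))

  enum-suc : ∀ n → IsLeastAbove P (enum n) (enum (suc n))
  enum-suc n = proj₂ (next (enum n))

  enum-suc-≡ : ∀ n {b} → IsLeastAbove P (enum n) b → enum (suc n) ≡ b
  enum-suc-≡ n = leastAbove-unique (enum-suc n)

  enum-< : ∀ n → enum n < enum (suc n)
  enum-< n = proj₁ (enum-suc n)

  enum-gap : ∀ n c → enum n < c → c < enum (suc n) → ¬ P c
  enum-gap n = proj₂ (proj₂ (enum-suc n))

  enum-∈ : ∀ n → 1 ≤ n → P (enum n)
  enum-∈ (suc n) _ = proj₁ (proj₂ (enum-suc n))

  enum-mono-≤ : ∀ {m n} → m ≤ n → enum m ≤ enum n
  enum-mono-≤ m≤n = mono (ℕP.≤⇒≤′ m≤n)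
    where
    mono : ∀ {m n} → m ≤′ n → enum m ≤ enum n
    mono ≤′-refl               = ℕP.≤-refl
    mono (≤′-step {n} m≤′n) = ℕP.≤-trans (mono m≤′n) (ℕP.<⇒≤ (enum-< n))

  enum-cancel-< : ∀ {m n} → enum m < enum n → m < n
  enum-cancel-< em<en = ℕP.≰⇒> (λ n≤m → ℕP.<⇒≱ em<en (enum-mono-≤ n≤m))

  n≤enum : ∀ n → n ≤ enum n
  n≤enum zero    = z≤n
  n≤enum (suc n) = ℕP.≤-trans (s≤s (n≤enum n)) (enum-< n)

  crossing : ∀ {b} k → 0 < b → b ≤ enum k → ∃[ n ] (enum n < b × b ≤ enum (suc n))
  crossing zero    0<b b≤0 = contradiction b≤0 (ℕP.<⇒≱ 0<b)
  crossing {b} (suc k) 0<b b≤enum[1+k] with b ℕ.≤? enum k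
  ... | yes b≤enum[k] = crossing k 0<b b≤enum[k]
  ... | no  b≰enum[k] = k , ℕP.≰⇒> b≰enum[k] , b≤enum[1+k]

  enum-surjective : ∀ b → 0 < b → P b → ∃[ n ] (1 ≤ n × enum n ≡ b)
  enum-surjective b 0<b Pb with crossing b 0<b (n≤enum b)
  ... | n , enum[n]<b , b≤enum[1+n] =
    suc n , s≤s z≤n ,
    ℕP.≤-antisym (ℕP.≮⇒≥ λ b<enum[1+n] → enum-gap n b enum[n]<b b<enum[1+n] Pb) b≤enum[1+n]

jSearch-≥ : ∀ a n i fuel {k} → jSearch a n i fuel ≡ just k → i ≤ k
jSearch-≥ a n i (suc fuel) found with does (inA? (a n ∸ a (n ∸ i)))
... | true  = ℕP.≤-reflexive (just-injective found)
... | false = ℕP.≤-trans (ℕP.n≤1+n i) (jSearch-≥ a n (suc i) fuel found)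

j≥1 : ∀ a n {k} → j a n ≡ just k → 1 ≤ k
j≥1 a n = jSearch-≥ a n 1 (n ∸ 1)

j≡1 : ∀ a n → 2 ≤ n → InA (a n ∸ a (n ∸ 1)) → j a n ≡ just 1
j≡1 a (suc zero)      (s≤s ()) _
j≡1 a n@(suc (suc m)) _        gap∈A =
  cong (λ hit → if hit then just 1 else jSearch a n 2 m) (dec-true (inA? (a n ∸ a (suc m))) gap∈A)

shiftedSquare+1 : ℤ → Poly
shiftedSquare+1 s = s * s + 1ℤ ∷ s + s ∷ 1ℤ ∷ []

eval-shiftedSquare+1 : ∀ s z → eval (shiftedSquare+1 s) z ≡ (s + z) * (s + z) + 1ℤ
eval-shiftedSquare+1 s z = expand s z
  where
  expand : ∀ s z → (s * s + 1ℤ) + z * ((s + s) + z * (1ℤ + z * 0ℤ)) ≡ (s + z) * (s + z) + 1ℤ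
  expand = solve-∀

square+1≢0 : ∀ i → i * i + 1ℤ ≢ 0ℤ
square+1≢0 (+ n) i²+1≡0 =
  ℕP.1+n≢0 (trans (ℕP.+-comm 1 (n ℕ.* n)) (ℤP.+-injective (trans (cong (_+ 1ℤ) (ℤP.pos-* n n)) i²+1≡0)))
square+1≢0 -[1+ n ] ()

shiftedSquare+1-irreducible : ∀ s → Irreducible (shiftedSquare+1 s)
shiftedSquare+1-irreducible s = monicQuadratic-irreducible (s * s + 1ℤ) (s + s)
  λ z root → square+1≢0 (s + z) (trans (sym (eval-shiftedSquare+1 s z)) root)

eval-shiftedSquare+1-pos : ∀ s x → eval (shiftedSquare+1 (+ s)) (+ x) ≡ + ((s ℕ.+ x) ℕ.* (s ℕ.+ x) ℕ.+ 1)
eval-shiftedSquare+1-pos s x =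
  trans (eval-shiftedSquare+1 (+ s) (+ x)) (cong (_+ 1ℤ) (sym (ℤP.pos-* (s ℕ.+ x) (s ℕ.+ x))))

isPrimeℤ⇒prime : ∀ {n} → IsPrimeℤ (+ n) → Prime n
isPrimeℤ⇒prime (q , +n≡+q , q-prime) = subst Prime (sym (ℤP.+-injective +n≡+q)) q-prime

twinSquares+1 : List Poly
twinSquares+1 = shiftedSquare+1 0ℤ ∷ shiftedSquare+1 (+ 2) ∷ []

-- The product of the values is 5 at 0, forcing p = 5, and 17 · 37 at 4.
twinSquares+1-bunyakovsky : Bunyakovsky twinSquares+1
twinSquares+1-bunyakovsky (p , p-prime , p∣) with
  prime⇒irreducible (from-yes (prime? 5)) (p∣ 0 (ℕ.>-nonZero⁻¹ p {{prime⇒nonZero p-prime}}))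
... | inj₁ refl = ¬prime[1] p-prime
... | inj₂ refl = from-no (5 ∣? 629) (p∣ 4 (ℕP.n<1+n 4))

-- Opaque: otherwise with-abstractions over terms mentioning enum normalise the irreducibility
-- proofs inside this witness and exhaust memory.
opaque
  twins-in-A : HypothesisH → ∀ N → ∃[ x ] (N < x × InA x × InA (2 ℕ.+ x))
  twins-in-A H N
    with H twinSquares+1 (shiftedSquare+1-irreducible 0ℤ ∷ shiftedSquare+1-irreducible (+ 2) ∷ [])
             (ℤ.+<+ (s≤s z≤n) ∷ ℤ.+<+ (s≤s z≤n) ∷ []) twinSquares+1-bunyakovsky N
  ... | x , N<x , (x²+1-prime ∷ [x+2]²+1-prime ∷ []) =
    x , N<x , (ℕP.m<n⇒0<n N<x , prime-at 0 x²+1-prime) , (s≤s z≤n , prime-at 2 [x+2]²+1-prime)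
    where
    prime-at : ∀ s → IsPrimeℤ (eval (shiftedSquare+1 (+ s)) (+ x)) → Prime ((s ℕ.+ x) ℕ.* (s ℕ.+ x) ℕ.+ 1)
    prime-at s = isPrimeℤ⇒prime ∘ subst IsPrimeℤ (eval-shiftedSquare+1-pos s x)

2∣square+1-or-next : ∀ x → 2 ∣ x ℕ.* x ℕ.+ 1 ⊎ 2 ∣ suc x ℕ.* suc x ℕ.+ 1
2∣square+1-or-next zero    = inj₂ (divides 1 refl)
2∣square+1-or-next (suc x) with 2∣square+1-or-next x
... | inj₂ 2∣[x+1]²+1 = inj₁ 2∣[x+1]²+1
... | inj₁ 2∣x²+1     = inj₂ (subst (2 ∣_) (expand x) (∣m∣n⇒∣m+n 2∣x²+1 (n∣m*n (x ℕ.+ x ℕ.+ 2))))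
  where
  expand : ∀ x → (x ℕ.* x ℕ.+ 1) ℕ.+ (x ℕ.+ x ℕ.+ 2) ℕ.* 2 ≡ suc (suc x) ℕ.* suc (suc x) ℕ.+ 1
  expand = ℕSolver.solve-∀

square+1-prime-even⇒≡1 : ∀ y → Prime (y ℕ.* y ℕ.+ 1) → 2 ∣ y ℕ.* y ℕ.+ 1 → y ≡ 1
square+1-prime-even⇒≡1 y y²+1-prime 2∣y²+1 with prime⇒irreducible y²+1-prime 2∣y²+1
... | inj₂ 2≡y²+1 = ℕP.m*n≡1⇒m≡1 y y (ℕP.suc-injective (trans (ℕP.+-comm 1 (y ℕ.* y)) (sym 2≡y²+1)))

A-no-consecutive : ∀ x → 2 ≤ x → InA x → ¬ InA (suc x)
A-no-consecutive x 2≤x (_ , x²+1-prime) (_ , [x+1]²+1-prime) with 2∣square+1-or-next x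
... | inj₁ 2∣x²+1     = ℕP.<⇒≢ 2≤x (sym (square+1-prime-even⇒≡1 x x²+1-prime 2∣x²+1))
... | inj₂ 2∣[x+1]²+1 =
  ℕP.<⇒≢ (ℕP.m≤n⇒m≤1+n 2≤x) (sym (square+1-prime-even⇒≡1 (suc x) [x+1]²+1-prime 2∣[x+1]²+1))

2∈A : InA 2
2∈A = s≤s z≤n , from-yes (prime? 5)

module _ (H : HypothesisH) where

  A-unbounded : ∀ N → ∃[ x ] (N < x × InA x)
  A-unbounded N = let x , N<x , x∈A , _ = twins-in-A H N in x , N<x , x∈A

  open Enumeration inA? A-unbounded

  twin⇒j≡1 : ∀ {N} → ∃[ x ] (suc (enum N) < x × InA x × InA (2 ℕ.+ x)) →
             ∃[ n ] (N ≤ n × 2 ≤ n × j enum n ≡ just 1)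
  twin⇒j≡1 {N} (x , 1+enum[N]<x , x∈A , 2+x∈A) with enum-surjective x (proj₁ x∈A) x∈A
  ... | m , 1≤m , refl = suc m , ℕP.<⇒≤ (ℕP.m≤n⇒m≤1+n N<m) , s≤s 1≤m , j≡1 enum (suc m) (s≤s 1≤m) gap∈A
    where
    N<m : N < m
    N<m = enum-cancel-< (ℕP.<-trans (ℕP.n<1+n (enum N)) 1+enum[N]<x)
    successor : enum (suc m) ≡ 2 ℕ.+ enum m
    successor = enum-suc-≡ m (leastAbove-skip (A-no-consecutive (enum m) 2≤x x∈A) (leastAbove-suc 2+x∈A))
      where
      2≤x : 2 ≤ enum m
      2≤x = ℕP.≤-trans (s≤s (s≤s z≤n)) 1+enum[N]<x
    gap∈A : InA (enum (suc m) ∸ enum m)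
    gap∈A = subst InA (sym (trans (cong (_∸ enum m) successor) (ℕP.m+n∸n≡m 2 (enum m)))) 2∈A

  j≡1-infinitely-often : ∀ N → ∃[ n ] (N ≤ n × 2 ≤ n × j enum n ≡ just 1)
  j≡1-infinitely-often N = twin⇒j≡1 (twins-in-A H (suc (enum N)))

proposition3 : HypothesisH → ∃[ a ] (IsEnumerationOfA a × LiminfEqOne (j a))
proposition3 H = enum , isEnumeration , j≡1-infinitely-often H , (0 , λ n _ _ → j≥1 enum n)
  where
  open Enumeration inA? (A-unbounded H)
  isEnumeration : IsEnumerationOfA enum
  isEnumeration = (λ n _ → enum-< n) , enum-∈ , λ b b∈A → enum-surjective b (proj₁ b∈A) b∈A
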